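{- For every natural number $n\ge2$, the problem $\text{2CC}_n$ is $(2k+1,k)$-universal for every integer $k\ge1$.
   Context: $\text{2CC}$ is the set of finite simple graphs, viewed as structures over $\sigma_g=\langle E^2\rangle$ with universe $\{0,\dots,m-1\}$ and $E$ symmetric and irreflexive, that admit a 2-coloring of the vertices such that no maximal clique is monochromatic. For a problem $S$ over a vocabulary $\sigma$, $S_n:=S\cup\{\mathcal A\in\mathrm{STRUC}[\sigma]:\|\mathcal A\|<n\}$, where $\|\mathcal A\|$ is the cardinality of the universe; so $\text{2CC}_n$ is $\text{2CC}$ together with all $\sigma_g$-structures of size less than $n$. Consistency and universality: given $m$ and a conjunction $\bigwedge_{j=1}^t L_j(u_j,v_j)$ with each $L_j\in\{E,\neg E\}$ and $u_j,v_j\in\{0,\dots,m-1\}$, it is $m$-consistent if some simple graph on vertex set $\{0,\dots,m-1\}$ satisfies it, and $m$-consistent in $S$ if some member of $S$ of size $m$ satisfies it. $S$ is $(n,t)$-universal if for every $m\ge n$ and every such conjunction of $t$ literals, $m$-consistency implies $m$-consistency in $S$. -}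

module Defs where

open import Data.Nat using (ℕ; _<_; _≥_)
open import Data.Bool using (Bool; true; false)
open import Data.Fin using (Fin)
open import Data.Fin.Subset using (Subset; _∈_; _⊆_)
open import Data.Vec using (Vec)
open import Data.Vec.Relation.Unary.All using (All)
open import Data.Product using (_×_; Σ; ∃)
open import Data.Sum using (_⊎_)
open import Data.Empty using (⊥)
open import Relation.Binary.PropositionalEquality using (_≡_; _≢_)

-- A σ_g-structure (σ_g = ⟨E²⟩) with universe {0,…,m-1}: a binary relation
-- E on Fin m (arbitrary, not necessarily symmetric/irreflexive), given as a
-- Bool-valued (decidable) relation since structures are finite.
Struc : ℕ → Set
Struc m = Fin m → Fin m → Bool

Problem : Set₁
Problem = (m : ℕ) → Struc m → Set

IsSimpleGraph : {m : ℕ} → Struc m → Set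
IsSimpleGraph {m} E = (∀ (u v : Fin m) → E u v ≡ E v u) × (∀ (u : Fin m) → E u u ≡ false)

IsClique : {m : ℕ} → Struc m → Subset m → Set
IsClique {m} E C = ∀ (u v : Fin m) → u ∈ C → v ∈ C → u ≢ v → E u v ≡ true

IsMaximalClique : {m : ℕ} → Struc m → Subset m → Set
IsMaximalClique {m} E C = IsClique E C × (∀ (D : Subset m) → IsClique E D → C ⊆ D → D ⊆ C)

Monochromatic : {m : ℕ} → (Fin m → Bool) → Subset m → Set
Monochromatic {m} c C = ∀ (u v : Fin m) → u ∈ C → v ∈ C → c u ≡ c v

TwoCC : Problem
TwoCC m E = IsSimpleGraph E ×
  Σ (Fin m → Bool) (λ c → ∀ (C : Subset m) → IsMaximalClique E C → Monochromatic c C → ⊥)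

_ₙ_ : Problem → ℕ → Problem
(S ₙ n) m A = S m A ⊎ m < n

-- literals L(u,v) with L ∈ {E, ¬E}; positive = true means E, false means ¬E
record Literal (m : ℕ) : Set where
  constructor lit
  field
    positive : Bool
    u : Fin m
    v : Fin m

Satisfies : {m : ℕ} → Struc m → Literal m → Set
Satisfies E (lit p u v) = E u v ≡ p

Conjunction : ℕ → ℕ → Set
Conjunction m t = Vec (Literal m) t

SatisfiesAll : {m t : ℕ} → Struc m → Conjunction m t → Set
SatisfiesAll E φ = All (Satisfies E) φ

Consistent : (m : ℕ) → {t : ℕ} → Conjunction m t → Set
Consistent m φ = Σ (Struc m) (λ G → IsSimpleGraph G × SatisfiesAll G φ)

ConsistentIn : Problem → (m : ℕ) → {t : ℕ} → Conjunction m t → Set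
ConsistentIn S m φ = Σ (Struc m) (λ A → S m A × SatisfiesAll A φ)

Universal : Problem → ℕ → ℕ → Set
Universal S n t = ∀ (m : ℕ) → m ≥ n → (φ : Conjunction m t) → Consistent m φ → ConsistentIn S m φ

-- The k literals of a conjunction mention at most 2k < m vertices, so some vertex w is
-- unconstrained. Join w to every other vertex of a witnessing simple graph: the literals
-- still hold, every maximal clique now contains w, and (as m ≥ 2) none is the singleton
-- {w}. Colouring w alone true thus leaves no maximal clique monochromatic, and the new
-- graph lies in 2CC itself, whatever n is.
module Submission where

open import Defs
open import Data.Nat using (ℕ; _≥_; _+_; _*_; _<_; _≤_; s≤s)
open import Data.Nat.Properties using (+-comm; *-comm; ≤-trans; <⇒≤; <⇒≱; *-monoˡ-≤)
open import Data.Bool using (Bool; true; false)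
open import Data.Fin using (Fin; zero; suc; _≟_)
open import Data.Fin.Properties using (¬∀⟶∃¬; injective⇒≤)
open import Data.Fin.Subset using (_∈_; _⊆_; _∪_; ⁅_⁆)
open import Data.Fin.Subset.Properties using (x∈⁅x⁆; x∈⁅y⁆⇒x≡y; x∈p∪q⁺; x∈p∪q⁻)
open import Data.Vec using (Vec; []; _∷_; lookup)
open import Data.Vec.Relation.Unary.All using ([]; _∷_)
open import Data.Vec.Relation.Unary.Any using (here; there; index; any?)
open import Data.Vec.Relation.Unary.Any.Properties using (lookup-index)
open import Data.Vec.Membership.Propositional using () renaming (_∈_ to _∈ᵥ_; _∉_ to _∉ᵥ_)
open import Data.Product using (_×_; ∃; _,_; proj₁; proj₂)
open import Data.Sum using (inj₁; inj₂)
open import Data.Empty using (⊥)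
open import Function using (_∘_)
open import Function.Definitions using (Injective)
open import Relation.Nullary using (¬_; yes; no; does; contradiction)
open import Relation.Nullary.Decidable using (dec-true)
open import Relation.Binary.PropositionalEquality using (_≡_; _≢_; refl; sym; trans; cong; subst)

length<⇒∃∉ : ∀ {d m} (vs : Vec (Fin m) d) → d < m → ∃ λ w → w ∉ᵥ vs
length<⇒∃∉ {d} {m} vs d<m = ¬∀⟶∃¬ m (_∈ᵥ vs) (λ w → any? (w ≟_) vs) ¬all∈
  where
  ¬all∈ : ¬ (∀ w → w ∈ᵥ vs)
  ¬all∈ all∈ = <⇒≱ d<m (injective⇒≤ index-injective)
    where
    index-injective : Injective _≡_ _≡_ (λ w → index (all∈ w))
    index-injective {a} {b} eq =
      trans (lookup-index (all∈ a)) (trans (cong (lookup vs) eq) (sym (lookup-index (all∈ b))))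

vertices : ∀ {m t} → Conjunction m t → Vec (Fin m) (t * 2)
vertices []              = []
vertices (lit _ u v ∷ φ) = u ∷ v ∷ vertices φ

module _ {m : ℕ} (E : Struc m) where

  Adjacent : Fin m → Fin m → Set
  Adjacent u v = E u v ≡ true × E v u ≡ true

  ⁅⁆-clique : ∀ a → IsClique E ⁅ a ⁆
  ⁅⁆-clique a u v u∈ v∈ u≢v
    with refl ← x∈⁅y⁆⇒x≡y a u∈ | refl ← x∈⁅y⁆⇒x≡y a v∈ = contradiction refl u≢v

  clique-∪⁅⁆ : ∀ {C w} → IsClique E C → (∀ v → v ∈ C → v ≢ w → Adjacent w v) →
               IsClique E (C ∪ ⁅ w ⁆)
  clique-∪⁅⁆ {C} {w} cl adj u v u∈ v∈ u≢v with x∈p∪q⁻ C ⁅ w ⁆ u∈ | x∈p∪q⁻ C ⁅ w ⁆ v∈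
  ... | inj₁ u∈C | inj₁ v∈C = cl u v u∈C v∈C u≢v
  ... | inj₁ u∈C | inj₂ v∈w with refl ← x∈⁅y⁆⇒x≡y w v∈w = proj₂ (adj u u∈C u≢v)
  ... | inj₂ u∈w | inj₁ v∈C with refl ← x∈⁅y⁆⇒x≡y w u∈w = proj₁ (adj v v∈C (u≢v ∘ sym))
  ... | inj₂ u∈w | inj₂ v∈w
    with refl ← x∈⁅y⁆⇒x≡y w u∈w | refl ← x∈⁅y⁆⇒x≡y w v∈w = contradiction refl u≢v

  dominating∈maximalClique : ∀ {C w} → (∀ v → v ≢ w → Adjacent w v) →
                             IsMaximalClique E C → w ∈ C
  dominating∈maximalClique {C} {w} adj (cl , maximal) =
    maximal (C ∪ ⁅ w ⁆) (clique-∪⁅⁆ cl (λ v _ → adj v)) (x∈p∪q⁺ ∘ inj₁) (x∈p∪q⁺ (inj₂ (x∈⁅x⁆ w)))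

  adjacent⇒¬maximalClique⊆⁅⁆ : ∀ {C w x} → x ≢ w → Adjacent w x → C ⊆ ⁅ w ⁆ →
                                ¬ IsMaximalClique E C
  adjacent⇒¬maximalClique⊆⁅⁆ {C} {w} {x} x≢w adj C⊆w (_ , maximal) = x≢w (x∈⁅y⁆⇒x≡y w (C⊆w x∈C))
    where
    pair-clique : IsClique E (⁅ x ⁆ ∪ ⁅ w ⁆)
    pair-clique = clique-∪⁅⁆ (⁅⁆-clique x) λ v v∈x _ → subst (Adjacent w) (sym (x∈⁅y⁆⇒x≡y x v∈x)) adj

    x∈C : x ∈ C
    x∈C = maximal (⁅ x ⁆ ∪ ⁅ w ⁆) pair-clique (x∈p∪q⁺ ∘ inj₂ ∘ C⊆w) (x∈p∪q⁺ (inj₁ (x∈⁅x⁆ x)))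

module _ {m : ℕ} (G : Struc m) (w : Fin m) where

  cone : Struc m
  cone a b with a ≟ w | b ≟ w
  ... | yes _ | yes _ = false
  ... | yes _ | no _  = true
  ... | no _  | yes _ = true
  ... | no _  | no _  = G a b

  cone-simple : IsSimpleGraph G → IsSimpleGraph cone
  cone-simple (symmetric , irreflexive) = cone-symmetric , cone-irreflexive
    where
    cone-symmetric : ∀ a b → cone a b ≡ cone b a
    cone-symmetric a b with a ≟ w | b ≟ w
    ... | yes _ | yes _ = refl
    ... | yes _ | no _  = refl
    ... | no _  | yes _ = refl
    ... | no _  | no _  = symmetric a b

    cone-irreflexive : ∀ a → cone a a ≡ false
    cone-irreflexive a with a ≟ w
    ... | yes _ = refl
    ... | no _  = irreflexive a

  cone-adjacent : ∀ v → v ≢ w → Adjacent cone w v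
  cone-adjacent v v≢w with w ≟ w | v ≟ w
  ... | no w≢w | _       = contradiction refl w≢w
  ... | yes _  | yes v≡w = contradiction v≡w v≢w
  ... | yes _  | no _    = refl , refl

  cone-≢ : ∀ {a b} → a ≢ w → b ≢ w → cone a b ≡ G a b
  cone-≢ {a} {b} a≢w b≢w with a ≟ w | b ≟ w
  ... | yes a≡w | _       = contradiction a≡w a≢w
  ... | no _    | yes b≡w = contradiction b≡w b≢w
  ... | no _    | no _    = refl

  cone-satisfiesAll : ∀ {t} (φ : Conjunction m t) → w ∉ᵥ vertices φ →
                      SatisfiesAll G φ → SatisfiesAll cone φ
  cone-satisfiesAll []              _  []           = []
  cone-satisfiesAll (lit _ u v ∷ φ) w∉ (sat ∷ sats) =
    trans (cone-≢ (w∉ ∘ here ∘ sym) (w∉ ∘ there ∘ here ∘ sym)) sat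
      ∷ cone-satisfiesAll φ (w∉ ∘ there ∘ there) sats

  isApex : Fin m → Bool
  isApex a = does (a ≟ w)

  monochromatic-apex⇒⊆⁅⁆ : ∀ {C} → w ∈ C → Monochromatic isApex C → C ⊆ ⁅ w ⁆
  monochromatic-apex⇒⊆⁅⁆ w∈C mono {v} v∈C with v ≟ w | mono v w v∈C w∈C
  ... | yes refl | _          = x∈⁅x⁆ w
  ... | no _     | false≡apex with () ← trans false≡apex (dec-true (w ≟ w) refl)

  cone-TwoCC : IsSimpleGraph G → ∀ {x} → x ≢ w → TwoCC m cone
  cone-TwoCC simple x≢w = cone-simple simple , isApex , no-monochromatic
    where
    no-monochromatic : ∀ C → IsMaximalClique cone C → Monochromatic isApex C → ⊥
    no-monochromatic _ maximal mono =
      adjacent⇒¬maximalClique⊆⁅⁆ cone x≢w (cone-adjacent _ x≢w)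
        (monochromatic-apex⇒⊆⁅⁆ (dominating∈maximalClique cone cone-adjacent maximal) mono)
        maximal

∃≢ : ∀ {m} → 2 ≤ m → (w : Fin m) → ∃ (_≢ w)
∃≢ (s≤s (s≤s _)) zero    = suc zero , λ ()
∃≢ (s≤s (s≤s _)) (suc _) = zero , λ ()

2*k+1≤⇒k*2< : ∀ {k m} → 2 * k + 1 ≤ m → k * 2 < m
2*k+1≤⇒k*2< {k} {m} = subst (_≤ m) (trans (+-comm (2 * k) 1) (cong (1 +_) (*-comm 2 k)))

corollary1 : ∀ (n : ℕ) → n ≥ 2 → ∀ (k : ℕ) → k ≥ 1 → Universal (TwoCC ₙ n) (2 * k + 1) k
corollary1 _ _ k k≥1 m m≥2k+1 φ (G , simple , sat)
  with w , w∉φ ← length<⇒∃∉ (vertices φ) (2*k+1≤⇒k*2< {k} m≥2k+1)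
  with _ , x≢w ← ∃≢ (≤-trans (*-monoˡ-≤ 2 k≥1) (<⇒≤ (2*k+1≤⇒k*2< {k} m≥2k+1))) w
  = cone G w , inj₁ (cone-TwoCC G w simple x≢w) , cone-satisfiesAll G w φ w∉φ sat
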